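{- Let $x$ be an integer. (1) Let $f:\mathbb{Z}\to\mathbb{C}$ satisfy $f(l_1)=-f(2x+2-l_1)$ for all $l_1$, and define $g(k_1,k_2)=\sum_{l_1=k_1}^{k_2}f(l_1)$. Then $g(k_1,k_2)=g(k_1,2x+1-k_2)$ for all $k_1,k_2\in\mathbb{Z}$. (2) Let $f:\mathbb{Z}^2\to\mathbb{C}$ satisfy $f(l_1,l_2)=f(l_1,2x+1-l_2)$ for all $l_1,l_2$ and $(\mathrm{id}+S_{l_1,l_2})V_{l_1,l_2}f(l_1,l_2)=0$. Define $g(k_1,k_2)=\sum_{l_1=k_1}^{k_2}\sum_{l_2=k_2}^{x}f(l_1,l_2)-f(k_2,k_2)$. Then $g(k_1,k_2)=-g(k_1,2x+2-k_2)$ for all $k_1,k_2\in\mathbb{Z}$.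
   Context: Convention: for integers $a>b$, $\sum_{i=a}^b h(i):=-\sum_{i=b+1}^{a-1}h(i)$ (in particular $\sum_{i=a}^{a-1}h(i)=0$). $S_{y,z}$ is the swapping operator $S_{y,z}f(y,z)=f(z,y)$, and $V_{y,z}=E_y+\Delta_y\Delta_z$ with $E_y f(y)=f(y+1)$, $\Delta_y=E_y-\mathrm{id}$; explicitly $V_{y,z}f(y,z)=f(y+1,z+1)-f(y,z+1)+f(y,z)$. -}

module Defs where

open import Level using (Level)
open import Algebra.Bundles using (CommutativeRing)
open import Data.Nat using (ℕ; zero; suc)
open import Data.Integer using (ℤ; +_; -[1+_]; _+_; _-_)

module _ {c ℓ : Level} (R : CommutativeRing c ℓ) where
  private
    module R = CommutativeRing R

  -- R has no 2-torsion: a + a ≈ 0 implies a ≈ 0 (true in ℂ).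
  TwoTorsionFree : Set _
  TwoTorsionFree = ∀ a → (a R.+ a) R.≈ R.0# → a R.≈ R.0#

  runSum : (ℤ → R.Carrier) → ℤ → ℕ → R.Carrier
  runSum h a zero    = R.0#
  runSum h a (suc n) = h a R.+ runSum h (a + + 1) n

  -- Σ_{i=a}^{b} h(i) with the paper's convention:
  --   a ≤ b+1 : the usual sum of h(a),...,h(b) (empty if a = b+1)
  --   a > b+1 : - Σ_{i=b+1}^{a-1} h(i)
  -- (if b - a + 1 = -[1+ m ] then b+1,...,a-1 are exactly suc m terms)
  ΣZ : (ℤ → R.Carrier) → ℤ → ℤ → R.Carrier
  ΣZ h a b with (b - a) + + 1
  ... | + n      = runSum h a n
  ... | -[1+ m ] = R.- runSum h (b + + 1) (suc m)

  V : (ℤ → ℤ → R.Carrier) → (ℤ → ℤ → R.Carrier)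
  V f y z = (f (y + + 1) (z + + 1) R.- f y (z + + 1)) R.+ f y z

  S : (ℤ → ℤ → R.Carrier) → (ℤ → ℤ → R.Carrier)
  S f y z = f z y

-- Sums are read off antiderivatives: if P (a + 1) = P a + h a for all a, then ΣZ h a b = P (b + 1) - P a
-- for all a and b, which is exactly the paper's convention for empty and reversed ranges.
--
-- (1) f is odd about x + 1, so f (x + 1) = 0 (R has no 2-torsion) and an antiderivative P of f is even:
-- P a = P (2x + 3 - a). At a = k₂ + 1 this equates the two sums.
--
-- (2) Let H (·, z) be the antiderivative of l₁ ↦ Σ_{l₂=z}^{x} f (l₁, l₂) vanishing at 0. Evenness of f in
-- l₂ makes H odd in z about x + 1, Δ₁Δ₂ H = - f, and g (k₁, k) = (V H)(k, k) - H (k₁, k); so it remains to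
-- show that T = (V H)(k, k) + (V H)(u, u) vanishes for u = 2x + 2 - k. As Δ₁Δ₂ commutes with V and S, the
-- hypothesis on f says that Φ = (id + S) V H has Δ₁Δ₂ Φ = 0, whence Φ(k,k) + Φ(u,u) = Φ(k,u) + Φ(u,k).
-- The left side is 2T; by oddness of H the right side is -2T plus values of (id + S) V f, which vanish
-- (on the diagonal after halving). Hence 4T = 0 and T = 0.

module Submission where

open import Defs
open import Level using (Level)
open import Algebra.Bundles using (CommutativeRing)
open import Data.Integer using (ℤ; +_; -[1+_]) renaming (_+_ to _+ℤ_; _-_ to _-ℤ_; _*_ to _*ℤ_)
open import Data.Nat using (zero; suc)
open import Data.Product using (_×_; _,_)
open import Relation.Binary.PropositionalEquality as ≡ using (_≡_)
import Data.Integer.Tactic.RingSolver as ℤ-Ring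

-- The ring solver is run with coefficients in ℤ, mapped into R by fromℤ: with R itself as
-- coefficient ring (and no decidable equality on it) the solver could not cancel terms.
module IntegerCoefficients {c ℓ : Level} (R : CommutativeRing c ℓ) where
  import Data.Nat as ℕ
  import Data.Nat.Properties as ℕ
  import Data.Integer as ℤ
  import Data.Integer.Properties as ℤ
  open import Data.Sign as Sign using (Sign)
  open import Data.Maybe using (Maybe; just; nothing)
  open import Relation.Nullary using (yes; no)
  open import Algebra.Solver.Ring.AlmostCommutativeRing
    using (_-Raw-AlmostCommutative⟶_; fromCommutativeRing)
  open CommutativeRing R hiding (zero)
  open import Algebra.Properties.Ring ring using (-0#≈0#; -‿involutive; -‿+-comm; -1*x≈-x)
  open import Algebra.Properties.Semiring.Mult semiring
    using (×-homo-+; ×1-homo-*) renaming (_×_ to _·_)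
  open import Algebra.Properties.CommutativeSemigroup *-commutativeSemigroup using (interchange)
  open import Relation.Binary.Reasoning.Setoid setoid

  fromℤ : ℤ → Carrier
  fromℤ (+ n)    = n · 1#
  fromℤ -[1+ n ] = - (suc n · 1#)

  fromSign : Sign → Carrier
  fromSign Sign.+ = 1#
  fromSign Sign.- = - 1#

  [x+y]-[x+z]≈y-z : ∀ x y z → (x + y) - (x + z) ≈ y - z
  [x+y]-[x+z]≈y-z x y z = begin
    (x + y) + - (x + z)   ≈⟨ +-congˡ (-‿+-comm x z) ⟨
    (x + y) + (- x + - z) ≈⟨ +-assoc x y _ ⟩
    x + (y + (- x + - z)) ≈⟨ +-congˡ (+-assoc y (- x) (- z)) ⟨
    x + ((y + - x) + - z) ≈⟨ +-congˡ (+-congʳ (+-comm y (- x))) ⟩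
    x + ((- x + y) + - z) ≈⟨ +-congˡ (+-assoc (- x) y (- z)) ⟩
    x + (- x + (y - z))   ≈⟨ +-assoc x (- x) _ ⟨
    (x + - x) + (y - z)   ≈⟨ +-congʳ (-‿inverseʳ x) ⟩
    0# + (y - z)          ≈⟨ +-identityˡ _ ⟩
    y - z                 ∎

  fromℤ-⊖ : ∀ m n → fromℤ (m ℤ.⊖ n) ≈ m · 1# - n · 1#
  fromℤ-⊖ m       zero    = sym (trans (+-congˡ -0#≈0#) (+-identityʳ _))
  fromℤ-⊖ zero    (suc n) = sym (+-identityˡ _)
  fromℤ-⊖ (suc m) (suc n) = begin
    fromℤ (suc m ℤ.⊖ suc n)  ≡⟨ ≡.cong fromℤ (ℤ.[1+m]⊖[1+n]≡m⊖n m n) ⟩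
    fromℤ (m ℤ.⊖ n)          ≈⟨ fromℤ-⊖ m n ⟩
    m · 1# - n · 1#          ≈⟨ [x+y]-[x+z]≈y-z 1# _ _ ⟨
    suc m · 1# - suc n · 1#  ∎

  fromℤ-+ : ∀ i j → fromℤ (i +ℤ j) ≈ fromℤ i + fromℤ j
  fromℤ-+ (+ m)    (+ n)    = ×-homo-+ 1# m n
  fromℤ-+ (+ m)    -[1+ n ] = fromℤ-⊖ m (suc n)
  fromℤ-+ -[1+ m ] (+ n)    = trans (fromℤ-⊖ n (suc m)) (+-comm _ _)
  fromℤ-+ -[1+ m ] -[1+ n ] = begin
    - (suc (suc (m ℕ.+ n)) · 1#)    ≡⟨ ≡.cong (λ k → - (suc k · 1#)) (ℕ.+-suc m n) ⟨
    - ((suc m ℕ.+ suc n) · 1#)      ≈⟨ -‿cong (×-homo-+ 1# (suc m) (suc n)) ⟩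
    - (suc m · 1# + suc n · 1#)     ≈⟨ -‿+-comm _ _ ⟨
    - (suc m · 1#) + - (suc n · 1#) ∎

  fromℤ-◃ : ∀ s n → fromℤ (s ℤ.◃ n) ≈ fromSign s * (n · 1#)
  fromℤ-◃ s       zero    = sym (zeroʳ _)
  fromℤ-◃ Sign.+  (suc n) = sym (*-identityˡ _)
  fromℤ-◃ Sign.-  (suc n) = sym (-1*x≈-x _)

  fromSign-* : ∀ s t → fromSign (s Sign.* t) ≈ fromSign s * fromSign t
  fromSign-* Sign.+ Sign.+ = sym (*-identityˡ _)
  fromSign-* Sign.+ Sign.- = sym (*-identityˡ _)
  fromSign-* Sign.- Sign.+ = sym (*-identityʳ _)
  fromSign-* Sign.- Sign.- = sym (trans (-1*x≈-x _) (-‿involutive _))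

  fromℤ-sign-abs : ∀ i → fromℤ i ≈ fromSign (ℤ.sign i) * (ℤ.∣ i ∣ · 1#)
  fromℤ-sign-abs i =
    trans (reflexive (≡.cong fromℤ (≡.sym (ℤ.◃-inverse i)))) (fromℤ-◃ (ℤ.sign i) ℤ.∣ i ∣)

  fromℤ-* : ∀ i j → fromℤ (i *ℤ j) ≈ fromℤ i * fromℤ j
  fromℤ-* i j = begin
    fromℤ (i *ℤ j)
      ≈⟨ fromℤ-◃ (ℤ.sign i Sign.* ℤ.sign j) (ℤ.∣ i ∣ ℕ.* ℤ.∣ j ∣) ⟩
    fromSign (ℤ.sign i Sign.* ℤ.sign j) * ((ℤ.∣ i ∣ ℕ.* ℤ.∣ j ∣) · 1#)
      ≈⟨ *-cong (fromSign-* (ℤ.sign i) (ℤ.sign j)) (×1-homo-* ℤ.∣ i ∣ ℤ.∣ j ∣) ⟩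
    (fromSign (ℤ.sign i) * fromSign (ℤ.sign j)) * ((ℤ.∣ i ∣ · 1#) * (ℤ.∣ j ∣ · 1#))
      ≈⟨ interchange _ _ _ _ ⟩
    (fromSign (ℤ.sign i) * (ℤ.∣ i ∣ · 1#)) * (fromSign (ℤ.sign j) * (ℤ.∣ j ∣ · 1#))
      ≈⟨ *-cong (fromℤ-sign-abs i) (fromℤ-sign-abs j) ⟨
    fromℤ i * fromℤ j
      ∎

  fromℤ-neg : ∀ i → fromℤ (ℤ.- i) ≈ - fromℤ i
  fromℤ-neg (+ zero)  = sym -0#≈0#
  fromℤ-neg (+ suc n) = refl
  fromℤ-neg -[1+ n ]  = sym (-‿involutive _)

  fromℤ-homomorphism : ℤ.+-*-rawRing -Raw-AlmostCommutative⟶ fromCommutativeRing R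
  fromℤ-homomorphism = record
    { ⟦_⟧ = fromℤ ; +-homo = fromℤ-+ ; *-homo = fromℤ-* ; -‿homo = fromℤ-neg
    ; 0-homo = refl ; 1-homo = +-identityʳ 1# }

  fromℤ-≟ : ∀ i j → Maybe (fromℤ i ≈ fromℤ j)
  fromℤ-≟ i j with i ℤ.≟ j
  ... | yes i≡j = just (reflexive (≡.cong fromℤ i≡j))
  ... | no  _   = nothing

  open import Algebra.Solver.Ring ℤ.+-*-rawRing (fromCommutativeRing R) fromℤ-homomorphism fromℤ-≟
    public

module DifferenceCalculus {c ℓ : Level} (R : CommutativeRing c ℓ) where
  import Data.Nat.Properties as ℕ
  import Data.Integer.Properties as ℤ
  open CommutativeRing R hiding (zero)
  open import Algebra.Properties.Ring ring
    using (x∙y⁻¹≈ε⇒x≈y; x≈y⇒x∙y⁻¹≈ε; +-inverseʳ-unique; -‿+-comm; -0#≈0#)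
  open IntegerCoefficients R using (solve; con; _:+_; _:-_; :-_; _:=_)
  open import Relation.Binary.Reasoning.Setoid setoid

  cong-≡ : (h : ℤ → Carrier) {a b : ℤ} → a ≡ b → h a ≈ h b
  cong-≡ h a≡b = reflexive (≡.cong h a≡b)

  shift-invariant⇒constant-+ : {F : ℤ → Carrier} → (∀ a → F (a +ℤ + 1) ≈ F a) →
                               ∀ a n → F (a +ℤ + n) ≈ F a
  shift-invariant⇒constant-+ {F} inv a zero    = cong-≡ F (ℤ.+-identityʳ a)
  shift-invariant⇒constant-+ {F} inv a (suc n) = begin
    F (a +ℤ + suc n)       ≡⟨ ≡.cong F (a+[1+n]≡[a+n]+1 a (+ n)) ⟨
    F ((a +ℤ + n) +ℤ + 1)  ≈⟨ inv (a +ℤ + n) ⟩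
    F (a +ℤ + n)           ≈⟨ shift-invariant⇒constant-+ inv a n ⟩
    F a                    ∎
    where
    a+[1+n]≡[a+n]+1 : ∀ a n → (a +ℤ n) +ℤ + 1 ≡ a +ℤ (+ 1 +ℤ n)
    a+[1+n]≡[a+n]+1 = ℤ-Ring.solve-∀

  shift-invariant⇒constant : {F : ℤ → Carrier} → (∀ a → F (a +ℤ + 1) ≈ F a) →
                             ∀ a b → F a ≈ F b
  shift-invariant⇒constant {F} inv a b with b -ℤ a in b-a≡
  ... | + n      = sym (trans (cong-≡ F (≡.trans (≡.sym (b≡a+[b-a] a b)) (≡.cong (a +ℤ_) b-a≡)))
                              (shift-invariant⇒constant-+ inv a n))
    where
    b≡a+[b-a] : ∀ a b → a +ℤ (b -ℤ a) ≡ b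
    b≡a+[b-a] = ℤ-Ring.solve-∀
  ... | -[1+ n ] = trans (cong-≡ F (≡.trans (≡.sym (b-[b-a]≡a a b)) (≡.cong (λ t → b -ℤ t) b-a≡)))
                         (shift-invariant⇒constant-+ inv b (suc n))
    where
    b-[b-a]≡a : ∀ a b → b -ℤ (b -ℤ a) ≡ a
    b-[b-a]≡a = ℤ-Ring.solve-∀

  Antiderivative : (ℤ → Carrier) → (ℤ → Carrier) → Set ℓ
  Antiderivative h P = ∀ a → P (a +ℤ + 1) ≈ P a + h a

  antiderivative : (ℤ → Carrier) → ℤ → Carrier
  antiderivative h (+ zero)     = 0#
  antiderivative h (+ suc n)    = antiderivative h (+ n) + h (+ n)
  antiderivative h -[1+ zero ]  = - h -[1+ zero ]
  antiderivative h -[1+ suc n ] = antiderivative h -[1+ n ] - h -[1+ suc n ]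

  antiderivative-isAntiderivative : ∀ h → Antiderivative h (antiderivative h)
  antiderivative-isAntiderivative h (+ n)         =
    cong-≡ (antiderivative h) (≡.cong +_ (ℕ.+-comm n 1))
  antiderivative-isAntiderivative h -[1+ zero ]   = sym (-‿inverseˡ _)
  antiderivative-isAntiderivative h -[1+ suc n ]  =
    solve 2 (λ p q → p := (p :- q) :+ q) refl (antiderivative h -[1+ n ]) (h -[1+ suc n ])

  module _ {h P : ℤ → Carrier} (P′ : Antiderivative h P) where

    runSum-antiderivative : ∀ a n → runSum R h a n ≈ P (a +ℤ + n) - P a
    runSum-antiderivative a zero    =
      sym (trans (+-congʳ (cong-≡ P (ℤ.+-identityʳ a))) (-‿inverseʳ (P a)))
    runSum-antiderivative a (suc n) = begin
      h a + runSum R h (a +ℤ + 1) n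
        ≈⟨ +-congˡ (runSum-antiderivative (a +ℤ + 1) n) ⟩
      h a + (P ((a +ℤ + 1) +ℤ + n) - P (a +ℤ + 1))
        ≈⟨ +-congˡ (+-cong (cong-≡ P (ℤ.+-assoc a (+ 1) (+ n))) (-‿cong (P′ a))) ⟩
      h a + (P (a +ℤ + suc n) - (P a + h a))
        ≈⟨ solve 3 (λ y q p → y :+ (q :- (p :+ y)) := q :- p) refl (h a) _ _ ⟩
      P (a +ℤ + suc n) - P a
        ∎

    ΣZ-antiderivative : ∀ a b → ΣZ R h a b ≈ P (b +ℤ + 1) - P a
    ΣZ-antiderivative a b with (b -ℤ a) +ℤ + 1 in length≡
    ... | + n      = trans (runSum-antiderivative a n) (+-congʳ (cong-≡ P
                       (≡.trans (≡.cong (a +ℤ_) (≡.sym length≡)) (a+[[b-a]+1]≡b+1 a b))))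
      where
      a+[[b-a]+1]≡b+1 : ∀ a b → a +ℤ ((b -ℤ a) +ℤ + 1) ≡ b +ℤ + 1
      a+[[b-a]+1]≡b+1 = ℤ-Ring.solve-∀
    ... | -[1+ n ] = begin
      - runSum R h (b +ℤ + 1) (suc n)
        ≈⟨ -‿cong (runSum-antiderivative (b +ℤ + 1) (suc n)) ⟩
      - (P ((b +ℤ + 1) +ℤ + suc n) - P (b +ℤ + 1))
        ≈⟨ -‿cong (+-congʳ (cong-≡ P (≡.trans (≡.cong ((b +ℤ + 1) -ℤ_) (≡.sym length≡))
                                             (b+1-[[b-a]+1]≡a a b)))) ⟩
      - (P a - P (b +ℤ + 1))
        ≈⟨ solve 2 (λ p q → :- (p :- q) := q :- p) refl _ _ ⟩
      P (b +ℤ + 1) - P a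
        ∎
      where
      b+1-[[b-a]+1]≡a : ∀ a b → (b +ℤ + 1) -ℤ ((b -ℤ a) +ℤ + 1) ≡ a
      b+1-[[b-a]+1]≡a = ℤ-Ring.solve-∀

    private
      [n+1]-[a+1]≡n-a : ∀ n a → (n +ℤ + 1) -ℤ (a +ℤ + 1) ≡ n -ℤ a
      [n+1]-[a+1]≡n-a = ℤ-Ring.solve-∀
      [n+1]-a≡[n-a]+1 : ∀ n a → (n +ℤ + 1) -ℤ a ≡ (n -ℤ a) +ℤ + 1
      [n+1]-a≡[n-a]+1 = ℤ-Ring.solve-∀

      reflected-step : ∀ n a → P ((n +ℤ + 1) -ℤ a) ≈ P ((n +ℤ + 1) -ℤ (a +ℤ + 1)) + h (n -ℤ a)
      reflected-step n a = begin
        P ((n +ℤ + 1) -ℤ a)                        ≡⟨ ≡.cong P ([n+1]-a≡[n-a]+1 n a) ⟩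
        P ((n -ℤ a) +ℤ + 1)                        ≈⟨ P′ (n -ℤ a) ⟩
        P (n -ℤ a) + h (n -ℤ a)                    ≡⟨ ≡.cong (λ t → P t + h (n -ℤ a))
                                                                ([n+1]-[a+1]≡n-a n a) ⟨
        P ((n +ℤ + 1) -ℤ (a +ℤ + 1)) + h (n -ℤ a)  ∎

    antiderivative-of-even : ∀ n → (∀ l → h l ≈ h (n -ℤ l)) →
      ∀ a b → P a + P ((n +ℤ + 1) -ℤ a) ≈ P b + P ((n +ℤ + 1) -ℤ b)
    antiderivative-of-even n even = shift-invariant⇒constant step
      where
      step : ∀ a → P (a +ℤ + 1) + P ((n +ℤ + 1) -ℤ (a +ℤ + 1)) ≈ P a + P ((n +ℤ + 1) -ℤ a)
      step a = begin
        P (a +ℤ + 1) + P ((n +ℤ + 1) -ℤ (a +ℤ + 1))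
          ≈⟨ +-congʳ (trans (P′ a) (+-congˡ (even a))) ⟩
        (P a + h (n -ℤ a)) + P ((n +ℤ + 1) -ℤ (a +ℤ + 1))
          ≈⟨ solve 3 (λ p q r → (p :+ r) :+ q := p :+ (q :+ r)) refl _ _ _ ⟩
        P a + (P ((n +ℤ + 1) -ℤ (a +ℤ + 1)) + h (n -ℤ a))
          ≈⟨ +-congˡ (reflected-step n a) ⟨
        P a + P ((n +ℤ + 1) -ℤ a)
          ∎

    antiderivative-of-odd : TwoTorsionFree R → ∀ n e → e +ℤ e ≡ n →
      (∀ l → h l ≈ - h (n -ℤ l)) → ∀ a → P a ≈ P ((n +ℤ + 1) -ℤ a)
    antiderivative-of-odd tf n e e+e≡n odd a =
      x∙y⁻¹≈ε⇒x≈y _ _ (trans (shift-invariant⇒constant step a e) vanishes-at-centre)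
      where
      step : ∀ a → P (a +ℤ + 1) - P ((n +ℤ + 1) -ℤ (a +ℤ + 1)) ≈ P a - P ((n +ℤ + 1) -ℤ a)
      step a = begin
        P (a +ℤ + 1) - P ((n +ℤ + 1) -ℤ (a +ℤ + 1))
          ≈⟨ +-congʳ (trans (P′ a) (+-congˡ (odd a))) ⟩
        (P a + - h (n -ℤ a)) - P ((n +ℤ + 1) -ℤ (a +ℤ + 1))
          ≈⟨ solve 3 (λ p q r → (p :+ :- r) :- q := p :- (q :+ r)) refl _ _ _ ⟩
        P a - (P ((n +ℤ + 1) -ℤ (a +ℤ + 1)) + h (n -ℤ a))
          ≈⟨ +-congˡ (-‿cong (reflected-step n a)) ⟨
        P a - P ((n +ℤ + 1) -ℤ a)
          ∎

      n-e≡e : n -ℤ e ≡ e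
      n-e≡e = ≡.trans (≡.cong (_-ℤ e) (≡.sym e+e≡n)) (e+e-e≡e e)
        where
        e+e-e≡e : ∀ e → (e +ℤ e) -ℤ e ≡ e
        e+e-e≡e = ℤ-Ring.solve-∀

      h[e]≈0 : h e ≈ 0#
      h[e]≈0 = tf (h e) (trans (+-congˡ (trans (odd e) (-‿cong (cong-≡ h n-e≡e))))
                               (-‿inverseʳ (h e)))

      vanishes-at-centre : P e - P ((n +ℤ + 1) -ℤ e) ≈ 0#
      vanishes-at-centre = begin
        P e - P ((n +ℤ + 1) -ℤ e) ≡⟨ ≡.cong (λ t → P e - P t)
                                       (≡.trans ([n+1]-a≡[n-a]+1 n e) (≡.cong (_+ℤ + 1) n-e≡e)) ⟩
        P e - P (e +ℤ + 1)        ≈⟨ +-congˡ (-‿cong (trans (P′ e) (+-congˡ h[e]≈0))) ⟩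
        P e - (P e + 0#)          ≈⟨ solve 1 (λ p → p :- (p :+ con (+ 0)) := con (+ 0)) refl (P e) ⟩
        0#                        ∎

  Δ₁Δ₂ : (ℤ → ℤ → Carrier) → ℤ → ℤ → Carrier
  Δ₁Δ₂ F y z = ((F (y +ℤ + 1) (z +ℤ + 1) - F y (z +ℤ + 1)) - F (y +ℤ + 1) z) + F y z

  Δ₁Δ₂≈0⇒rectangle : ∀ {Φ} → (∀ y z → Δ₁Δ₂ Φ y z ≈ 0#) →
                     ∀ a b a′ b′ → Φ a b + Φ a′ b′ ≈ Φ a b′ + Φ a′ b
  Δ₁Δ₂≈0⇒rectangle {Φ} flat a b a′ b′ = x∙y⁻¹≈ε⇒x≈y _ _ (begin
    (Φ a b + Φ a′ b′) - (Φ a b′ + Φ a′ b)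
      ≈⟨ solve 4 (λ p q r s → (p :+ q) :- (r :+ s) := (p :- s) :- (r :- q)) refl _ _ _ _ ⟩
    (Φ a b - Φ a′ b) - (Φ a b′ - Φ a′ b′)
      ≈⟨ x≈y⇒x∙y⁻¹≈ε (shift-invariant⇒constant column-step b b′) ⟩
    0# ∎)
    where
    row-step : ∀ z y → Φ (y +ℤ + 1) (z +ℤ + 1) - Φ (y +ℤ + 1) z ≈ Φ y (z +ℤ + 1) - Φ y z
    row-step z y = x∙y⁻¹≈ε⇒x≈y _ _ (trans
      (solve 4 (λ p q r s → (p :- r) :- (q :- s) := ((p :- q) :- r) :+ s) refl
        (Φ (y +ℤ + 1) (z +ℤ + 1)) (Φ y (z +ℤ + 1)) (Φ (y +ℤ + 1) z) (Φ y z))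
      (flat y z))

    column-step : ∀ z → Φ a (z +ℤ + 1) - Φ a′ (z +ℤ + 1) ≈ Φ a z - Φ a′ z
    column-step z = x∙y⁻¹≈ε⇒x≈y _ _ (trans
      (solve 4 (λ p q r s → (p :- r) :- (q :- s) := (p :- q) :- (r :- s)) refl
        (Φ a (z +ℤ + 1)) (Φ a z) (Φ a′ (z +ℤ + 1)) (Φ a′ z))
      (x≈y⇒x∙y⁻¹≈ε (shift-invariant⇒constant (row-step z) a a′)))

  Δ₁Δ₂-+ : ∀ F G y z → Δ₁Δ₂ (λ y z → F y z + G y z) y z ≈ Δ₁Δ₂ F y z + Δ₁Δ₂ G y z
  Δ₁Δ₂-+ F G y z = solve 8
    (λ p q r s p′ q′ r′ s′ →
      (((p :+ p′) :- (q :+ q′)) :- (r :+ r′)) :+ (s :+ s′)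
      := (((p :- q) :- r) :+ s) :+ (((p′ :- q′) :- r′) :+ s′))
    refl (F (y +ℤ + 1) (z +ℤ + 1)) (F y (z +ℤ + 1)) (F (y +ℤ + 1) z) (F y z)
         (G (y +ℤ + 1) (z +ℤ + 1)) (G y (z +ℤ + 1)) (G (y +ℤ + 1) z) (G y z)

  Δ₁Δ₂-S : ∀ F y z → Δ₁Δ₂ (S R F) y z ≈ S R (Δ₁Δ₂ F) y z
  Δ₁Δ₂-S F y z = solve 4 (λ p q r s → ((p :- q) :- r) :+ s := ((p :- r) :- q) :+ s) refl
    (F (z +ℤ + 1) (y +ℤ + 1)) (F (z +ℤ + 1) y) (F z (y +ℤ + 1)) (F z y)

  Δ₁Δ₂-V : ∀ F y z → Δ₁Δ₂ (V R F) y z ≈ V R (Δ₁Δ₂ F) y z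
  Δ₁Δ₂-V F y z = solve 8
    (λ a b c d e g h i →
      ((((a :- b) :+ c) :- ((b :- d) :+ e)) :- ((g :- c) :+ h)) :+ ((c :- e) :+ i)
      := ((((a :- b) :- g) :+ c) :- (((b :- d) :- c) :+ e)) :+ (((c :- e) :- h) :+ i))
    refl (F y₂ z₂) (F y₁ z₂) (F y₁ z₁) (F y z₂) (F y z₁) (F y₂ z₁) (F y₁ z) (F y z)
    where
    y₁ y₂ z₁ z₂ : ℤ
    y₁ = y +ℤ + 1
    y₂ = y₁ +ℤ + 1
    z₁ = z +ℤ + 1
    z₂ = z₁ +ℤ + 1

  V-neg : ∀ {φ ψ} → (∀ y z → φ y z ≈ - ψ y z) → ∀ y z → V R φ y z ≈ - V R ψ y z
  V-neg {φ} {ψ} φ≈-ψ y z = begin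
    (φ (y +ℤ + 1) (z +ℤ + 1) - φ y (z +ℤ + 1)) + φ y z
      ≈⟨ +-cong (+-cong (φ≈-ψ _ _) (-‿cong (φ≈-ψ _ _))) (φ≈-ψ _ _) ⟩
    (- ψ (y +ℤ + 1) (z +ℤ + 1) - - ψ y (z +ℤ + 1)) + - ψ y z
      ≈⟨ solve 3 (λ p q r → (:- p :- :- q) :+ :- r := :- ((p :- q) :+ r)) refl _ _ _ ⟩
    - ((ψ (y +ℤ + 1) (z +ℤ + 1) - ψ y (z +ℤ + 1)) + ψ y z)
      ∎

  V≈E+Δ₁Δ₂ : ∀ F y z → V R F y z ≈ F (y +ℤ + 1) z + Δ₁Δ₂ F y z
  V≈E+Δ₁Δ₂ F y z = solve 4 (λ p q r s → (p :- q) :+ s := r :+ (((p :- q) :- r) :+ s)) refl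
    (F (y +ℤ + 1) (z +ℤ + 1)) (F y (z +ℤ + 1)) (F (y +ℤ + 1) z) (F y z)

  sum-of-zeros : ∀ {a b} → a ≈ 0# → b ≈ 0# → a + b ≈ 0#
  sum-of-zeros a≈0 b≈0 = trans (+-cong a≈0 b≈0) (+-identityʳ 0#)

  module OddInSecondArgument (tf : TwoTorsionFree R) (m : ℤ) (H : ℤ → ℤ → Carrier)
    (H-odd : ∀ y z → H y z + H y (m -ℤ z) ≈ 0#)
    (flat : ∀ y z → V R (Δ₁Δ₂ H) y z + S R (V R (Δ₁Δ₂ H)) y z ≈ 0#) where

    private
      d : ℤ → ℤ → Carrier
      d = Δ₁Δ₂ H

      H-reflect : ∀ y {z z′} → z +ℤ z′ ≡ m → H y z′ ≈ - H y z
      H-reflect y {z} {z′} z+z′≡m =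
        trans (cong-≡ (H y) (≡.trans (≡.sym ([z+z′]-z≡z′ z z′)) (≡.cong (_-ℤ z) z+z′≡m)))
              (+-inverseʳ-unique _ _ (H-odd y z))
        where
        [z+z′]-z≡z′ : ∀ z z′ → (z +ℤ z′) -ℤ z ≡ z′
        [z+z′]-z≡z′ = ℤ-Ring.solve-∀

      [z+1]+z′≡z+[z′+1] : ∀ z z′ → (z +ℤ + 1) +ℤ z′ ≡ z +ℤ (z′ +ℤ + 1)
      [z+1]+z′≡z+[z′+1] = ℤ-Ring.solve-∀

      d-reflect : ∀ y {z z′} → (z +ℤ + 1) +ℤ z′ ≡ m → d y z′ ≈ d y z
      d-reflect y {z} {z′} e = begin
        ((H (y +ℤ + 1) (z′ +ℤ + 1) - H y (z′ +ℤ + 1)) - H (y +ℤ + 1) z′) + H y z′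
          ≈⟨ +-cong (+-cong (+-cong (H-reflect _ e′) (-‿cong (H-reflect _ e′)))
                            (-‿cong (H-reflect _ e)))
                    (H-reflect _ e) ⟩
        ((- H (y +ℤ + 1) z - - H y z) - - H (y +ℤ + 1) (z +ℤ + 1)) + - H y (z +ℤ + 1)
          ≈⟨ solve 4 (λ p q r s → ((:- p :- :- q) :- :- r) :+ :- s := ((r :- s) :- p) :+ q)
                     refl _ _ _ _ ⟩
        ((H (y +ℤ + 1) (z +ℤ + 1) - H y (z +ℤ + 1)) - H (y +ℤ + 1) z) + H y z
          ∎
        where
        e′ : z +ℤ (z′ +ℤ + 1) ≡ m
        e′ = ≡.trans (≡.sym ([z+1]+z′≡z+[z′+1] z z′)) e

      V-reflect : ∀ y w z′ → (w +ℤ + 1) +ℤ z′ ≡ m →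
                  V R H y (w +ℤ + 1) + V R H y z′ ≈ d y (w +ℤ + 1) + d y w
      V-reflect y w z′ e = begin
        V R H y (w +ℤ + 1) + ((H y₁ (z′ +ℤ + 1) - H y (z′ +ℤ + 1)) + H y z′)
          ≈⟨ +-congˡ (+-cong (+-cong (H-reflect _ e′) (-‿cong (H-reflect _ e′))) (H-reflect _ e)) ⟩
        ((H y₁ w₂ - H y w₂) + H y w₁) + ((- H y₁ w - - H y w) + - H y w₁)
          ≈⟨ solve 6 (λ a b c g h k →
               ((a :- b) :+ c) :+ ((:- g :- :- h) :+ :- c)
               := (((a :- b) :- k) :+ c) :+ (((k :- c) :- g) :+ h)) refl
               (H y₁ w₂) (H y w₂) (H y w₁) (H y₁ w) (H y w) (H y₁ w₁) ⟩
        d y w₁ + d y w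
          ∎
        where
        y₁ w₁ w₂ : ℤ
        y₁ = y +ℤ + 1
        w₁ = w +ℤ + 1
        w₂ = w₁ +ℤ + 1
        e′ : w +ℤ (z′ +ℤ + 1) ≡ m
        e′ = ≡.trans (≡.sym ([z+1]+z′≡z+[z′+1] w z′)) e

      Vd-diagonal : ∀ a → V R d a a ≈ 0#
      Vd-diagonal a = tf _ (flat a a)

      Vd-reflect : ∀ a b → (a +ℤ + 1) +ℤ (b +ℤ + 1) ≡ m →
                   V R d a b ≈ (d (a +ℤ + 1) a - d a a) + d a (a +ℤ + 1)
      Vd-reflect a b e =
        +-cong (+-cong (d-reflect _ e) (-‿cong (d-reflect _ e))) (d-reflect _ e′)
        where
        e′ : ((a +ℤ + 1) +ℤ + 1) +ℤ b ≡ m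
        e′ = ≡.trans ([z+1]+z′≡z+[z′+1] (a +ℤ + 1) b) e

      near-diagonal-sum≈0 : ∀ a b → (a +ℤ + 1) +ℤ (b +ℤ + 1) ≡ m →
        (d (a +ℤ + 1) (a +ℤ + 1) + d (a +ℤ + 1) a) + (d (b +ℤ + 1) (b +ℤ + 1) + d (b +ℤ + 1) b) ≈ 0#
      near-diagonal-sum≈0 a b e = begin
        (d a₁ a₁ + d a₁ a) + (d b₁ b₁ + d b₁ b)
          ≈⟨ solve 8 (λ p q r s p′ q′ r′ s′ →
               (p :+ s) :+ (p′ :+ s′)
               := (((p :- q) :+ r) :+ ((p′ :- q′) :+ r′))
                  :+ (((s :- r) :+ q) :+ ((s′ :- r′) :+ q′))) refl
               (d a₁ a₁) (d a a₁) (d a a) (d a₁ a) (d b₁ b₁) (d b b₁) (d b b) (d b₁ b) ⟩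
        (V R d a a + V R d b b) + (((d a₁ a - d a a) + d a a₁) + ((d b₁ b - d b b) + d b b₁))
          ≈⟨ +-cong (sum-of-zeros (Vd-diagonal a) (Vd-diagonal b))
                    (sym (+-cong (Vd-reflect a b e) (Vd-reflect b a (≡.trans (ℤ.+-comm b₁ a₁) e)))) ⟩
        0# + (V R d a b + S R (V R d) a b)
          ≈⟨ sum-of-zeros refl (flat a b) ⟩
        0#
          ∎
        where
        a₁ b₁ : ℤ
        a₁ = a +ℤ + 1
        b₁ = b +ℤ + 1

      Φ : ℤ → ℤ → Carrier
      Φ y z = V R H y z + S R (V R H) y z

      Φ-flat : ∀ y z → Δ₁Δ₂ Φ y z ≈ 0#
      Φ-flat y z = begin
        Δ₁Δ₂ Φ y z
          ≈⟨ Δ₁Δ₂-+ (V R H) (S R (V R H)) y z ⟩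
        Δ₁Δ₂ (V R H) y z + Δ₁Δ₂ (S R (V R H)) y z
          ≈⟨ +-cong (Δ₁Δ₂-V H y z) (trans (Δ₁Δ₂-S (V R H) y z) (Δ₁Δ₂-V H z y)) ⟩
        V R d y z + S R (V R d) y z
          ≈⟨ flat y z ⟩
        0#
          ∎

      V-diagonal-pair : ∀ a b → (a +ℤ + 1) +ℤ (b +ℤ + 1) ≡ m →
                        V R H (a +ℤ + 1) (a +ℤ + 1) + V R H (b +ℤ + 1) (b +ℤ + 1) ≈ 0#
      V-diagonal-pair a b e = tf T (tf (T + T) (begin
        (T + T) + (T + T)
          ≈⟨ solve 2 (λ p q → ((p :+ q) :+ (p :+ q)) :+ ((p :+ q) :+ (p :+ q))
                              := ((p :+ p) :+ (q :+ q)) :+ ((p :+ q) :+ (p :+ q)))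
                     refl (V R H k k) (V R H u u) ⟩
        (Φ k k + Φ u u) + (T + T)
          ≈⟨ +-congʳ (Δ₁Δ₂≈0⇒rectangle Φ-flat k k u u) ⟩
        (Φ k u + Φ u k) + (T + T)
          ≈⟨ +-congʳ (+-cong Φ-antidiagonal (trans (+-comm _ _) Φ-antidiagonal)) ⟩
        (- T + - T) + (T + T)
          ≈⟨ solve 1 (λ t → (:- t :+ :- t) :+ (t :+ t) := con (+ 0)) refl T ⟩
        0#
          ∎))
        where
        k u : ℤ
        k = a +ℤ + 1
        u = b +ℤ + 1
        T : Carrier
        T = V R H k k + V R H u u
        Φ-antidiagonal : Φ k u ≈ - T
        Φ-antidiagonal = begin
          V R H k u + V R H u k
            ≈⟨ solve 4 (λ p q r s → q :+ s := ((p :+ q) :+ (r :+ s)) :- (p :+ r))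
                       refl (V R H k k) (V R H k u) (V R H u u) (V R H u k) ⟩
          ((V R H k k + V R H k u) + (V R H u u + V R H u k)) - T
            ≈⟨ +-congʳ (+-cong (V-reflect k a u e) (V-reflect u b k (≡.trans (ℤ.+-comm u k) e))) ⟩
          ((d k k + d k a) + (d u u + d u b)) - T
            ≈⟨ +-congʳ (near-diagonal-sum≈0 a b e) ⟩
          0# - T
            ≈⟨ +-identityˡ (- T) ⟩
          - T
            ∎

    V-diagonal-odd : ∀ k → V R H k k + V R H (m -ℤ k) (m -ℤ k) ≈ 0#
    V-diagonal-odd k = begin
      V R H k k + V R H (m -ℤ k) (m -ℤ k)
        ≡⟨ ≡.cong₂ (λ s t → V R H s s + V R H t t) (≡.sym ([k-1]+1≡k k)) (≡.sym ([k-1]+1≡k u)) ⟩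
      V R H ((k -ℤ + 1) +ℤ + 1) ((k -ℤ + 1) +ℤ + 1) + V R H ((u -ℤ + 1) +ℤ + 1) ((u -ℤ + 1) +ℤ + 1)
        ≈⟨ V-diagonal-pair (k -ℤ + 1) (u -ℤ + 1) (pair-sum m k) ⟩
      0#
        ∎
      where
      u : ℤ
      u = m -ℤ k
      [k-1]+1≡k : ∀ k → (k -ℤ + 1) +ℤ + 1 ≡ k
      [k-1]+1≡k = ℤ-Ring.solve-∀
      pair-sum : ∀ m k → ((k -ℤ + 1) +ℤ + 1) +ℤ (((m -ℤ k) -ℤ + 1) +ℤ + 1) ≡ m
      pair-sum = ℤ-Ring.solve-∀

  ΣZ-reflect-upper : TwoTorsionFree R → ∀ x (f : ℤ → Carrier) →
    (∀ l → f l ≈ - f ((+ 2 *ℤ x +ℤ + 2) -ℤ l)) →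
    ∀ k₁ k₂ → ΣZ R f k₁ k₂ ≈ ΣZ R f k₁ ((+ 2 *ℤ x +ℤ + 1) -ℤ k₂)
  ΣZ-reflect-upper tf x f f-odd k₁ k₂ = begin
    ΣZ R f k₁ k₂                          ≈⟨ ΣZ-antiderivative P′ k₁ k₂ ⟩
    P (k₂ +ℤ + 1) - P k₁                  ≈⟨ +-congʳ (P-even (k₂ +ℤ + 1)) ⟩
    P ((m +ℤ + 1) -ℤ (k₂ +ℤ + 1)) - P k₁  ≡⟨ ≡.cong (λ t → P t - P k₁) (reflected-bound x k₂) ⟩
    P ((n -ℤ k₂) +ℤ + 1) - P k₁           ≈⟨ ΣZ-antiderivative P′ k₁ (n -ℤ k₂) ⟨
    ΣZ R f k₁ (n -ℤ k₂)                   ∎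
    where
    n : ℤ
    n = + 2 *ℤ x +ℤ + 1
    m : ℤ
    m = + 2 *ℤ x +ℤ + 2
    P : ℤ → Carrier
    P = antiderivative f
    P′ : Antiderivative f P
    P′ = antiderivative-isAntiderivative f
    centre : ∀ x → (x +ℤ + 1) +ℤ (x +ℤ + 1) ≡ + 2 *ℤ x +ℤ + 2
    centre = ℤ-Ring.solve-∀
    P-even : ∀ a → P a ≈ P ((m +ℤ + 1) -ℤ a)
    P-even = antiderivative-of-odd P′ tf m (x +ℤ + 1) (centre x) f-odd
    reflected-bound : ∀ x k →
      ((+ 2 *ℤ x +ℤ + 2) +ℤ + 1) -ℤ (k +ℤ + 1) ≡ ((+ 2 *ℤ x +ℤ + 1) -ℤ k) +ℤ + 1
    reflected-bound = ℤ-Ring.solve-∀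

  module DoubleSum (x : ℤ) (f : ℤ → ℤ → Carrier) where

    m : ℤ
    m = + 2 *ℤ x +ℤ + 2

    G : ℤ → ℤ → Carrier
    G y z = ΣZ R (f y) z x

    H : ℤ → ℤ → Carrier
    H y z = antiderivative (λ y′ → G y′ z) y

    g : ℤ → ℤ → Carrier
    g k₁ k₂ = ΣZ R (λ l₁ → G l₁ k₂) k₁ k₂ - f k₂ k₂

    H′ : ∀ z → Antiderivative (λ y → G y z) (λ y → H y z)
    H′ z = antiderivative-isAntiderivative (λ y → G y z)

    G-step : ∀ y z → G y z ≈ f y z + G y (z +ℤ + 1)
    G-step y z = begin
      G y z                                   ≈⟨ ΣZ-antiderivative p′ z x ⟩
      p (x +ℤ + 1) - p z                      ≈⟨ solve 3 (λ q r s → q :- r := s :+ (q :- (r :+ s)))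
                                                         refl _ _ _ ⟩
      f y z + (p (x +ℤ + 1) - (p z + f y z))  ≈⟨ +-congˡ (+-congˡ (-‿cong (p′ z))) ⟨
      f y z + (p (x +ℤ + 1) - p (z +ℤ + 1))   ≈⟨ +-congˡ (ΣZ-antiderivative p′ (z +ℤ + 1) x) ⟨
      f y z + G y (z +ℤ + 1)                  ∎
      where
      p : ℤ → Carrier
      p = antiderivative (f y)
      p′ : Antiderivative (f y) p
      p′ = antiderivative-isAntiderivative (f y)

    Δ₁Δ₂H≈-f : ∀ y z → Δ₁Δ₂ H y z ≈ - f y z
    Δ₁Δ₂H≈-f y z = begin
      ((H (y +ℤ + 1) (z +ℤ + 1) - H y (z +ℤ + 1)) - H (y +ℤ + 1) z) + H y z
        ≈⟨ +-congʳ (+-cong (+-congʳ (H′ (z +ℤ + 1) y)) (-‿cong (H′ z y))) ⟩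
      (((H y (z +ℤ + 1) + G y (z +ℤ + 1)) - H y (z +ℤ + 1)) - (H y z + G y z)) + H y z
        ≈⟨ +-congʳ (+-congˡ (-‿cong (+-congˡ (G-step y z)))) ⟩
      (((H y (z +ℤ + 1) + G y (z +ℤ + 1)) - H y (z +ℤ + 1)) - (H y z + (f y z + G y (z +ℤ + 1))))
        + H y z
        ≈⟨ solve 4 (λ a b c q → (((a :+ b) :- a) :- (c :+ (q :+ b))) :+ c := :- q) refl _ _ _ _ ⟩
      - f y z
        ∎

    g≈V-H : ∀ k₁ k → g k₁ k ≈ V R H k k - H k₁ k
    g≈V-H k₁ k = begin
      ΣZ R (λ l₁ → G l₁ k) k₁ k - f k k
        ≈⟨ +-congʳ (ΣZ-antiderivative (H′ k) k₁ k) ⟩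
      (H (k +ℤ + 1) k - H k₁ k) - f k k
        ≈⟨ solve 3 (λ a b q → (a :- b) :- q := (a :+ :- q) :- b) refl _ _ _ ⟩
      (H (k +ℤ + 1) k + - f k k) - H k₁ k
        ≈⟨ +-congʳ (trans (V≈E+Δ₁Δ₂ H k k) (+-congˡ (Δ₁Δ₂H≈-f k k))) ⟨
      V R H k k - H k₁ k
        ∎

    module _ (f-even : ∀ l₁ l₂ → f l₁ l₂ ≈ f l₁ ((+ 2 *ℤ x +ℤ + 1) -ℤ l₂)) where

      G-odd : ∀ y z → G y z + G y (m -ℤ z) ≈ 0#
      G-odd y z = begin
        G y z + G y (m -ℤ z)
          ≈⟨ +-cong (ΣZ-antiderivative p′ z x) (ΣZ-antiderivative p′ (m -ℤ z) x) ⟩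
        (p j - p z) + (p j - p (m -ℤ z))
          ≈⟨ solve 3 (λ a b c → (a :- b) :+ (a :- c) := (a :+ a) :- (b :+ c)) refl _ _ _ ⟩
        (p j + p j) - (p z + p (m -ℤ z))
          ≈⟨ x≈y⇒x∙y⁻¹≈ε (sym p-odd) ⟩
        0#
          ∎
        where
        j : ℤ
        j = x +ℤ + 1
        p : ℤ → Carrier
        p = antiderivative (f y)
        p′ : Antiderivative (f y) p
        p′ = antiderivative-isAntiderivative (f y)
        n : ℤ
        n = + 2 *ℤ x +ℤ + 1
        [n+1]-z≡m-z : ∀ x z → ((+ 2 *ℤ x +ℤ + 1) +ℤ + 1) -ℤ z ≡ (+ 2 *ℤ x +ℤ + 2) -ℤ z
        [n+1]-z≡m-z = ℤ-Ring.solve-∀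
        p-odd : p z + p (m -ℤ z) ≈ p j + p j
        p-odd = begin
          p z + p (m -ℤ z)              ≡⟨ ≡.cong (λ t → p z + p t) ([n+1]-z≡m-z x z) ⟨
          p z + p ((n +ℤ + 1) -ℤ z)     ≈⟨ antiderivative-of-even p′ n (f-even y) z j ⟩
          p j + p ((n +ℤ + 1) -ℤ j)     ≡⟨ ≡.cong (λ t → p j + p t) ([n+1]-z≡m-z x j) ⟩
          p j + p (m -ℤ j)              ≡⟨ ≡.cong (λ t → p j + p t) (m-j≡j x) ⟩
          p j + p j                     ∎
          where
          m-j≡j : ∀ x → (+ 2 *ℤ x +ℤ + 2) -ℤ (x +ℤ + 1) ≡ x +ℤ + 1
          m-j≡j = ℤ-Ring.solve-∀

      -- Compared with y = + 0, where both terms are 0# by the definition of antiderivative.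
      H-odd : ∀ y z → H y z + H y (m -ℤ z) ≈ 0#
      H-odd y z = trans (shift-invariant⇒constant step y (+ 0)) (+-identityʳ 0#)
        where
        step : ∀ y → H (y +ℤ + 1) z + H (y +ℤ + 1) (m -ℤ z) ≈ H y z + H y (m -ℤ z)
        step y = begin
          H (y +ℤ + 1) z + H (y +ℤ + 1) (m -ℤ z)
            ≈⟨ +-cong (H′ z y) (H′ (m -ℤ z) y) ⟩
          (H y z + G y z) + (H y (m -ℤ z) + G y (m -ℤ z))
            ≈⟨ solve 4 (λ a b c e → (a :+ b) :+ (c :+ e) := (a :+ c) :+ (b :+ e)) refl _ _ _ _ ⟩
          (H y z + H y (m -ℤ z)) + (G y z + G y (m -ℤ z))
            ≈⟨ +-congˡ (G-odd y z) ⟩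
          (H y z + H y (m -ℤ z)) + 0#
            ≈⟨ +-identityʳ _ ⟩
          H y z + H y (m -ℤ z)
            ∎

      module _ (tf : TwoTorsionFree R)
               (f-flat : ∀ l₁ l₂ → (V R f l₁ l₂ + S R (V R f) l₁ l₂) ≈ 0#) where

        H-flat : ∀ y z → V R (Δ₁Δ₂ H) y z + S R (V R (Δ₁Δ₂ H)) y z ≈ 0#
        H-flat y z = begin
          V R (Δ₁Δ₂ H) y z + V R (Δ₁Δ₂ H) z y  ≈⟨ +-cong (V-neg Δ₁Δ₂H≈-f y z) (V-neg Δ₁Δ₂H≈-f z y) ⟩
          - V R f y z + - V R f z y            ≈⟨ -‿+-comm _ _ ⟩
          - (V R f y z + V R f z y)            ≈⟨ -‿cong (f-flat y z) ⟩
          - 0#                                 ≈⟨ -0#≈0# ⟩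
          0#                                   ∎

        open OddInSecondArgument tf m H H-odd H-flat using (V-diagonal-odd)

        g-odd : ∀ k₁ k → g k₁ k ≈ - g k₁ (m -ℤ k)
        g-odd k₁ k = +-inverseʳ-unique _ _ (begin
          g k₁ (m -ℤ k) + g k₁ k
            ≈⟨ +-cong (g≈V-H k₁ (m -ℤ k)) (g≈V-H k₁ k) ⟩
          (V R H (m -ℤ k) (m -ℤ k) - H k₁ (m -ℤ k)) + (V R H k k - H k₁ k)
            ≈⟨ solve 4 (λ a b c e → (a :- b) :+ (c :- e) := (c :+ a) :- (e :+ b)) refl _ _ _ _ ⟩
          (V R H k k + V R H (m -ℤ k) (m -ℤ k)) - (H k₁ k + H k₁ (m -ℤ k))
            ≈⟨ +-cong (V-diagonal-odd k) (-‿cong (H-odd k₁ k)) ⟩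
          0# - 0#
            ≈⟨ -‿inverseʳ 0# ⟩
          0#
            ∎)

lemma6 : ∀ {c ℓ : Level} (R : CommutativeRing c ℓ) → TwoTorsionFree R → (x : ℤ) →
    let open CommutativeRing R in
    -- (1)
    ((f : ℤ → Carrier) →
      (∀ l₁ → f l₁ ≈ - f ((+ 2 *ℤ x +ℤ + 2) -ℤ l₁)) →
      ∀ k₁ k₂ → ΣZ R f k₁ k₂ ≈ ΣZ R f k₁ ((+ 2 *ℤ x +ℤ + 1) -ℤ k₂))
    ×
    -- (2)
    ((f : ℤ → ℤ → Carrier) →
      (∀ l₁ l₂ → f l₁ l₂ ≈ f l₁ ((+ 2 *ℤ x +ℤ + 1) -ℤ l₂)) →
      (∀ l₁ l₂ → (V R f l₁ l₂ + S R (V R f) l₁ l₂) ≈ 0#) →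
      ∀ k₁ k₂ →
        (ΣZ R (λ l₁ → ΣZ R (λ l₂ → f l₁ l₂) k₂ x) k₁ k₂ - f k₂ k₂)
        ≈ - (ΣZ R (λ l₁ → ΣZ R (λ l₂ → f l₁ l₂) ((+ 2 *ℤ x +ℤ + 2) -ℤ k₂) x) k₁ ((+ 2 *ℤ x +ℤ + 2) -ℤ k₂)
              - f ((+ 2 *ℤ x +ℤ + 2) -ℤ k₂) ((+ 2 *ℤ x +ℤ + 2) -ℤ k₂)))
lemma6 R tf x =
    ΣZ-reflect-upper tf x
  , λ f f-even f-flat → DoubleSum.g-odd x f f-even tf f-flat
  where open DifferenceCalculus R
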